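{- For $n\ge1$ and $i\ge0$ let $\mathcal{C}_{(\geq,\geq)}(n,i)$ be the set of Catalan words of length $n$ avoiding the pattern $(\geq,\geq)$ with last letter $i$, and define \[ C_i^{\geq}(x;q)=\sum_{n\geq 1}x^n \sum_{w\in \mathcal{C}_{(\geq, \geq)}(n,i)}q^{\mathrm{inter}(w)},\qquad C^{\geq}(x;q;v)=\sum_{i \geq 0}C_i^{\geq}(x;q)v^{i}. \] Then \[ C^{\geq}(x;q;v)=x+x^2+\frac{x^2}{1-qv}C^{\geq}(x;q;q)+xv\,C^{\geq}(x;q;qv)-\frac{x^2q^2v^2}{1-qv}C^{\geq}(x;q;q^2 v). \]
   Context: A Catalan word of length $n\ge 0$ is a sequence $w=w_1\cdots w_n$ of non-negative integers with $w_1=0$ and $0\le w_i\le w_{i-1}+1$ for $i=2,\dots,n$. It avoids the pattern $(\geq,\geq)$ if there is no index $i$ with $w_i\ge w_{i+1}\ge w_{i+2}$. To $w$ is associated the polyomino $P(w)$ with $n$ bottom-aligned columns, the $i$-th column consisting of $w_i+1$ unit cells. $\mathrm{inter}(w)$ is the number of interior points of $P(w)$, i.e. lattice points that belong to exactly four cells of $P(w)$. -}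

module Defs where

open import Data.Bool using (Bool; true; false; _∧_; not; if_then_else_)
open import Data.Nat using (ℕ; zero; suc; _+_; _*_; _∸_; _≤ᵇ_; _≡ᵇ_)
open import Data.List using (List; []; _∷_; map; concatMap; upTo; length)
open import Data.Nat.ListAction using (sum)
open import Relation.Binary.PropositionalEquality using (_≡_)
open import Data.Integer using (ℤ; +_) renaming (_+_ to _+ℤ_; _-_ to _-ℤ_; _*_ to _*ℤ_)

stepOK : ℕ → List ℕ → Bool
stepOK p []       = true
stepOK p (y ∷ ys) = (y ≤ᵇ suc p) ∧ stepOK y ys

isCatalan : List ℕ → Bool
isCatalan []       = true
isCatalan (x ∷ xs) = (x ≡ᵇ 0) ∧ stepOK x xs

avoidsGeGe : List ℕ → Bool
avoidsGeGe (a ∷ b ∷ c ∷ r) = not ((b ≤ᵇ a) ∧ (c ≤ᵇ b)) ∧ avoidsGeGe (b ∷ c ∷ r)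
avoidsGeGe _               = true

lastIs : List ℕ → ℕ → Bool
lastIs []           i = false
lastIs (x ∷ [])     i = x ≡ᵇ i
lastIs (x ∷ y ∷ ys) i = lastIs (y ∷ ys) i

-- Polyomino P(w): the cell whose lower-left corner is (c , r) belongs to P(w)
-- iff 0 ≤ c < n and r ≤ w_{c+1}  (column c+1 has w_{c+1}+1 cells).
inCell : List ℕ → ℕ → ℕ → Bool
inCell []       c       r = false
inCell (h ∷ hs) zero    r = r ≤ᵇ h
inCell (h ∷ hs) (suc c) r = inCell hs c r

-- a lattice point (x , y) with x , y ≥ 1 belongs to exactly four cells of P(w)
-- iff the four cells with lower-left corners (x-1,y-1),(x,y-1),(x-1,y),(x,y) are in P(w)
-- (points with x = 0 or y = 0 lie in at most two cells).
interiorPt : List ℕ → ℕ → ℕ → Bool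
interiorPt w (suc x) (suc y) =
  inCell w x y ∧ inCell w (suc x) y ∧ inCell w x (suc y) ∧ inCell w (suc x) (suc y)
interiorPt w _ _ = false

countB : {A : Set} → (A → Bool) → List A → ℕ
countB p []       = 0
countB p (a ∷ as) = (if p a then 1 else 0) + countB p as

-- all lattice points of P(w) lie in [0, n] × [0, n] (since w_i < n), n = length w
inter : List ℕ → ℕ
inter w = sum (map (λ x → countB (λ y → interiorPt w x y) (upTo (suc n))) (upTo (suc n)))
  where n = length w

words : ℕ → ℕ → List (List ℕ)
words zero    k = [] ∷ []
words (suc l) k = concatMap (λ d → map (d ∷_) (words l k)) (upTo k)

-- Formal power series in x, q, v with integer coefficients:
-- S n a b is the coefficient of x^n q^a v^b.

Series : Set
Series = ℕ → ℕ → ℕ → ℤ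

_≈S_ : Series → Series → Set
F ≈S G = ∀ n a b → F n a b ≡ G n a b

infix 4 _≈S_
infixl 6 _⊕_ _⊖_
infixl 7 _⊛_

_⊕_ : Series → Series → Series
(F ⊕ G) n a b = F n a b +ℤ G n a b

_⊖_ : Series → Series → Series
(F ⊖ G) n a b = F n a b -ℤ G n a b

sumTo : ℕ → (ℕ → ℤ) → ℤ
sumTo zero    f = + 0
sumTo (suc m) f = sumTo m f +ℤ f m

_⊛_ : Series → Series → Series
(F ⊛ G) n a b =
  sumTo (suc n) λ n₁ → sumTo (suc a) λ a₁ → sumTo (suc b) λ b₁ →
    F n₁ a₁ b₁ *ℤ G (n ∸ n₁) (a ∸ a₁) (b ∸ b₁)

mono : ℕ → ℕ → ℕ → Series
mono i j k n a b = if (n ≡ᵇ i) ∧ (a ≡ᵇ j) ∧ (b ≡ᵇ k) then + 1 else + 0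

-- 1 / (1 - q v) = Σ_m q^m v^m
geomQV : Series
geomQV n a b = if (n ≡ᵇ 0) ∧ (a ≡ᵇ b) then + 1 else + 0

-- substitution v ↦ q^k v^m :  F(x;q;q^k v^m)
-- coefficient of x^n q^a v^b is Σ_{j : j*m = b, j*k ≤ a} [x^n q^(a - j k) v^j] F
-- (all such j satisfy j ≤ a + b when k + m ≥ 1; used below only with k + m ≥ 1)
substV : ℕ → ℕ → Series → Series
substV k m F n a b =
  sumTo (suc (a + b)) λ j →
    if ((j * m) ≡ᵇ b) ∧ ((j * k) ≤ᵇ a) then F n (a ∸ (j * k)) j else + 0

Cgeq : Series
Cgeq zero    a b = + 0
Cgeq (suc l) a b = + countB
  (λ w → isCatalan w ∧ avoidsGeGe w ∧ lastIs w b ∧ (inter w ≡ᵇ a))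
  (words (suc l) (suc l))

{-# OPTIONS --safe #-}
-- The last letter b of a word in the class follows its previous letter j either by an ascent,
-- b = j + 1, which adds min(j, j + 1) = j interior points (the term x v C(x;q;qv)), or by a weak
-- descent b ≤ j.  In the latter case j was itself reached by an ascent from i = j − 1, because
-- (≥,≥) is avoided, and the last two columns add min(i, i + 1) + min(i + 1, b) = i + b interior
-- points; summing q^(i+b) v^b over 0 ≤ b ≤ i + 1 gives x²(C(x;q;q) − q²v² C(x;q;q²v))/(1 − qv).
-- The words 0 and 00 contribute x + x².  Interior points are counted as inter(w) = Σ min(wᵢ, wᵢ₊₁),
-- and the identity is checked on natural-number coefficients, with the subtracted term moved to
-- the other side.
module Submission where

open import Algebra.Properties.CommutativeSemigroup using (interchange)
open import Data.Bool using (Bool; true; false; _∧_; not; if_then_else_; T)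
open import Data.Bool.Properties using (∧-assoc; ∧-identityʳ; ∧-zeroʳ; if-eta; if-∧; if-float)
open import Data.Bool.Solver using (module ∨-∧-Solver)
import Data.Integer as ℤ
import Data.Integer.Properties as ℤ
open import Data.List using (List; []; _∷_; _++_; _∷ʳ_; map; concatMap; applyUpTo; upTo; length)
open import Data.List.Relation.Unary.All as All using (All; []; _∷_)
open import Data.Nat using (ℕ; zero; suc; _+_; _*_; _∸_; _≤ᵇ_; _≡ᵇ_; _<ᵇ_; _≤_; _<_; z≤n; s≤s; z<s; _⊓_)
open import Data.Nat.ListAction using (sum)
open import Data.Nat.Properties
open import Data.Sum using (inj₁; inj₂)
open import Function using (_∘_; _⟨_⟩_)
open import Relation.Binary.Definitions using (tri<; tri≈; tri>)
open import Relation.Binary.PropositionalEquality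
open import Relation.Nullary using (¬_; yes; no; ofʸ; ofⁿ; contradiction)
open import Relation.Nullary.Decidable using (dec-true; dec-false; T?)

open import Defs

open ∨-∧-Solver using (solve; _:*_; _:=_)

-- Finite sums

∑ : ℕ → (ℕ → ℕ) → ℕ
∑ zero    f = 0
∑ (suc m) f = ∑ m f + f m

∑-cong : ∀ m {f g : ℕ → ℕ} → (∀ x → x < m → f x ≡ g x) → ∑ m f ≡ ∑ m g
∑-cong zero    f≡g = refl
∑-cong (suc m) f≡g = cong₂ _+_ (∑-cong m (λ x x<m → f≡g x (m<n⇒m<1+n x<m))) (f≡g m ≤-refl)

∑-zero : ∀ m {f : ℕ → ℕ} → (∀ x → x < m → f x ≡ 0) → ∑ m f ≡ 0
∑-zero zero    f≡0 = refl
∑-zero (suc m) f≡0 = cong₂ _+_ (∑-zero m (λ x x<m → f≡0 x (m<n⇒m<1+n x<m))) (f≡0 m ≤-refl)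

∑-distrib-+ : ∀ m (f g : ℕ → ℕ) → ∑ m (λ x → f x + g x) ≡ ∑ m f + ∑ m g
∑-distrib-+ zero    f g = refl
∑-distrib-+ (suc m) f g = begin
  ∑ m (λ x → f x + g x) + (f m + g m)  ≡⟨ cong (_+ (f m + g m)) (∑-distrib-+ m f g) ⟩
  ∑ m f + ∑ m g + (f m + g m)          ≡⟨ interchange +-commutativeSemigroup (∑ m f) (∑ m g) (f m) (g m) ⟩
  ∑ m f + f m + (∑ m g + g m)          ∎
  where open ≡-Reasoning

∑-comm : ∀ m k (h : ℕ → ℕ → ℕ) → ∑ m (λ x → ∑ k (h x)) ≡ ∑ k (λ y → ∑ m (λ x → h x y))
∑-comm zero    k h = sym (∑-zero k (λ _ _ → refl))
∑-comm (suc m) k h = begin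
  ∑ m (λ x → ∑ k (h x)) + ∑ k (h m)          ≡⟨ cong (_+ ∑ k (h m)) (∑-comm m k h) ⟩
  ∑ k (λ y → ∑ m (λ x → h x y)) + ∑ k (h m)  ≡⟨ sym (∑-distrib-+ k (λ y → ∑ m (λ x → h x y)) (h m)) ⟩
  ∑ k (λ y → ∑ m (λ x → h x y) + h m y)      ∎
  where open ≡-Reasoning

∑-head : ∀ m (f : ℕ → ℕ) → ∑ (suc m) f ≡ f 0 + ∑ m (f ∘ suc)
∑-head zero    f = +-comm 0 (f 0)
∑-head (suc m) f = trans (cong (_+ f (suc m)) (∑-head m f)) (+-assoc (f 0) (∑ m (f ∘ suc)) (f (suc m)))

∑-reverse : ∀ m (f : ℕ → ℕ) → ∑ m f ≡ ∑ m (λ x → f (m ∸ suc x))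
∑-reverse zero    f = refl
∑-reverse (suc m) f = begin
  ∑ m f + f m                          ≡⟨ cong (_+ f m) (∑-reverse m f) ⟩
  ∑ m (λ x → f (m ∸ suc x)) + f m      ≡⟨ +-comm _ (f m) ⟩
  f m + ∑ m (λ x → f (m ∸ suc x))      ≡⟨ sym (∑-head m (λ x → f (suc m ∸ suc x))) ⟩
  ∑ (suc m) (λ x → f (suc m ∸ suc x))  ∎
  where open ≡-Reasoning

∑-truncate : ∀ {n} m (f : ℕ → ℕ) → n ≤ m → (∀ x → n ≤ x → x < m → f x ≡ 0) → ∑ m f ≡ ∑ n f
∑-truncate         zero    f z≤n   f≡0 = refl
∑-truncate {n} (suc m) f n≤1+m f≡0 with m≤n⇒m<n∨m≡n n≤1+m
... | inj₂ refl      = refl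
... | inj₁ (s≤s n≤m) = begin
  ∑ m f + f m  ≡⟨ cong (∑ m f +_) (f≡0 m n≤m ≤-refl) ⟩
  ∑ m f + 0    ≡⟨ +-identityʳ (∑ m f) ⟩
  ∑ m f        ≡⟨ ∑-truncate m f n≤m (λ x n≤x x<m → f≡0 x n≤x (m<n⇒m<1+n x<m)) ⟩
  ∑ n f        ∎
  where open ≡-Reasoning

∑-single : ∀ m k (f : ℕ → ℕ) → k < m → (∀ x → x < m → x ≢ k → f x ≡ 0) → ∑ m f ≡ f k
∑-single (suc m) k f k<1+m f≡0 with m ≟ k
... | yes refl = begin
  ∑ m f + f m  ≡⟨ cong (_+ f m) (∑-zero m (λ x x<m → f≡0 x (m<n⇒m<1+n x<m) (<⇒≢ x<m))) ⟩
  f m          ∎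
  where open ≡-Reasoning
... | no m≢k = begin
  ∑ m f + f m  ≡⟨ cong₂ _+_ (∑-single m k f k<m (λ x x<m → f≡0 x (m<n⇒m<1+n x<m))) (f≡0 m ≤-refl m≢k) ⟩
  f k + 0      ≡⟨ +-identityʳ (f k) ⟩
  f k          ∎
  where
  open ≡-Reasoning
  k<m = ≤∧≢⇒< (≤-pred k<1+m) (m≢k ∘ sym)

∑-single-≤ᵇ : ∀ n k (f : ℕ → ℕ) → (∀ x → x ≤ n → x ≢ k → f x ≡ 0) →
              ∑ (suc n) f ≡ (if k ≤ᵇ n then f k else 0)
∑-single-≤ᵇ n k f f≡0 with k ≤ᵇ n | ≤ᵇ-reflects-≤ k n
... | true  | ofʸ k≤n = ∑-single (suc n) k f (s≤s k≤n) (λ x x<1+n → f≡0 x (≤-pred x<1+n))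
... | false | ofⁿ k≰n = ∑-zero (suc n) (λ x x<1+n → f≡0 x (≤-pred x<1+n) (λ { refl → k≰n (≤-pred x<1+n) }))

⟦_⟧ : Bool → ℕ
⟦ b ⟧ = if b then 1 else 0

⟦⟧-zero : ∀ {p} → ¬ T p → ⟦ p ⟧ ≡ 0
⟦⟧-zero {false} _  = refl
⟦⟧-zero {true}  ¬p = contradiction _ ¬p

⟦⟧≢0⇒T : ∀ {p} → ⟦ p ⟧ ≢ 0 → T p
⟦⟧≢0⇒T {true}  _       = _
⟦⟧≢0⇒T {false} nonzero = nonzero refl

⟦not⟧-* : ∀ p x → ⟦ not p ⟧ * x ≡ (if p then 0 else x)
⟦not⟧-* true  x = refl
⟦not⟧-* false x = +-identityʳ x

T-∧ˡ : ∀ {x y} → T (x ∧ y) → T x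
T-∧ˡ {true} _ = _

T-∧ʳ : ∀ {x y} → T (x ∧ y) → T y
T-∧ʳ {true} t = t

≤ᵇ-true : ∀ {m n} → m ≤ n → (m ≤ᵇ n) ≡ true
≤ᵇ-true = dec-true (_ ≤? _)

≤ᵇ-false : ∀ {m n} → ¬ m ≤ n → (m ≤ᵇ n) ≡ false
≤ᵇ-false = dec-false (_ ≤? _)

≡ᵇ-true : ∀ {m n} → m ≡ n → (m ≡ᵇ n) ≡ true
≡ᵇ-true = dec-true (_ ≟ _)

≡ᵇ-false : ∀ {m n} → m ≢ n → (m ≡ᵇ n) ≡ false
≡ᵇ-false = dec-false (_ ≟ _)

+≡ᵇ-∸ : ∀ i m a → (i + m ≡ᵇ a) ≡ (m ≤ᵇ a) ∧ (i ≡ᵇ a ∸ m)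
+≡ᵇ-∸ i m a with m ≤ᵇ a | ≤ᵇ-reflects-≤ m a
... | false | ofⁿ m≰a = ≡ᵇ-false (λ i+m≡a → m≰a (subst (m ≤_) i+m≡a (m≤n+m m i)))
... | true  | ofʸ m≤a with i ≟ a ∸ m
...   | yes refl = ≡ᵇ-true (m∸n+n≡m m≤a) ⟨ trans ⟩ sym (≡ᵇ-true {a ∸ m} refl)
...   | no  i≢   = ≡ᵇ-false (λ i+m≡a → i≢ (trans (sym (m+n∸n≡m i m)) (cong (_∸ m) i+m≡a)))
                   ⟨ trans ⟩ sym (≡ᵇ-false i≢)

-- Sums over words

countB-++ : ∀ {A : Set} (p : A → Bool) xs ys → countB p (xs ++ ys) ≡ countB p xs + countB p ys
countB-++ p []       ys = refl
countB-++ p (x ∷ xs) ys = trans (cong (⟦ p x ⟧ +_) (countB-++ p xs ys)) (sym (+-assoc ⟦ p x ⟧ _ _))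

countB-concatMap : ∀ {A B : Set} (p : B → Bool) (g : A → List B) xs →
                   countB p (concatMap g xs) ≡ sum (map (countB p ∘ g) xs)
countB-concatMap p g []       = refl
countB-concatMap p g (x ∷ xs) =
  trans (countB-++ p (g x) (concatMap g xs)) (cong (countB p (g x) +_) (countB-concatMap p g xs))

countB-map : ∀ {A B : Set} (p : B → Bool) (g : A → B) xs → countB p (map g xs) ≡ countB (p ∘ g) xs
countB-map p g []       = refl
countB-map p g (x ∷ xs) = cong (⟦ p (g x) ⟧ +_) (countB-map p g xs)

countB≡sum-map : ∀ {A : Set} (p : A → Bool) xs → countB p xs ≡ sum (map (⟦_⟧ ∘ p) xs)
countB≡sum-map p []       = refl
countB≡sum-map p (x ∷ xs) = cong (⟦ p x ⟧ +_) (countB≡sum-map p xs)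

sum-map-applyUpTo : ∀ m (g f : ℕ → ℕ) → sum (map g (applyUpTo f m)) ≡ ∑ m (g ∘ f)
sum-map-applyUpTo zero    g f = refl
sum-map-applyUpTo (suc m) g f =
  trans (cong (g (f 0) +_) (sum-map-applyUpTo m g (f ∘ suc))) (sym (∑-head m (g ∘ f)))

countB-upTo : ∀ m (p : ℕ → Bool) → countB p (upTo m) ≡ ∑ m (⟦_⟧ ∘ p)
countB-upTo m p = trans (countB≡sum-map p (upTo m)) (sum-map-applyUpTo m (⟦_⟧ ∘ p) (λ x → x))

∑Words : ℕ → ℕ → (List ℕ → ℕ) → ℕ
∑Words zero    K f = f []
∑Words (suc l) K f = ∑ K (λ d → ∑Words l K (λ w → f (d ∷ w)))

countB-words : ∀ l K (p : List ℕ → Bool) → countB p (words l K) ≡ ∑Words l K (⟦_⟧ ∘ p)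
countB-words zero    K p = +-identityʳ ⟦ p [] ⟧
countB-words (suc l) K p = begin
  countB p (concatMap (λ d → map (d ∷_) (words l K)) (upTo K))  ≡⟨ countB-concatMap p _ (upTo K) ⟩
  sum (map (λ d → countB p (map (d ∷_) (words l K))) (upTo K))  ≡⟨ sum-map-applyUpTo K _ (λ d → d) ⟩
  ∑ K (λ d → countB p (map (d ∷_) (words l K)))                 ≡⟨ ∑-cong K (λ d _ → byFirstLetter d) ⟩
  ∑Words (suc l) K (⟦_⟧ ∘ p)                                     ∎
  where
  open ≡-Reasoning
  byFirstLetter : ∀ d → countB p (map (d ∷_) (words l K)) ≡ ∑Words l K (λ w → ⟦ p (d ∷ w) ⟧)
  byFirstLetter d = trans (countB-map p (d ∷_) (words l K)) (countB-words l K (λ w → p (d ∷ w)))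

∑Words-cong : ∀ l K {f g : List ℕ → ℕ} → (∀ w → length w ≡ l → f w ≡ g w) → ∑Words l K f ≡ ∑Words l K g
∑Words-cong zero    K f≡g = f≡g [] refl
∑Words-cong (suc l) K f≡g = ∑-cong K (λ d _ → ∑Words-cong l K (λ w |w| → f≡g (d ∷ w) (cong suc |w|)))

∑Words-zero : ∀ l K {f : List ℕ → ℕ} → (∀ w → length w ≡ l → f w ≡ 0) → ∑Words l K f ≡ 0
∑Words-zero zero    K f≡0 = f≡0 [] refl
∑Words-zero (suc l) K f≡0 = ∑-zero K (λ d _ → ∑Words-zero l K (λ w |w| → f≡0 (d ∷ w) (cong suc |w|)))

∑Words-distrib-+ : ∀ l K (f g : List ℕ → ℕ) → ∑Words l K (λ w → f w + g w) ≡ ∑Words l K f + ∑Words l K g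
∑Words-distrib-+ zero    K f g = refl
∑Words-distrib-+ (suc l) K f g =
  trans (∑-cong K (λ d _ → ∑Words-distrib-+ l K (f ∘ (d ∷_)) (g ∘ (d ∷_))))
        (∑-distrib-+ K (λ d → ∑Words l K (f ∘ (d ∷_))) (λ d → ∑Words l K (g ∘ (d ∷_))))

∑Words-∧ : ∀ l K c (p : List ℕ → Bool) →
           ∑Words l K (λ w → ⟦ c ∧ p w ⟧) ≡ (if c then ∑Words l K (⟦_⟧ ∘ p) else 0)
∑Words-∧ l K true  p = refl
∑Words-∧ l K false p = ∑Words-zero l K (λ _ _ → refl)

∑Words-∑ : ∀ l K m (h : ℕ → List ℕ → ℕ) →
           ∑Words l K (λ w → ∑ m (λ j → h j w)) ≡ ∑ m (λ j → ∑Words l K (h j))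
∑Words-∑ zero    K m h = refl
∑Words-∑ (suc l) K m h = trans (∑-cong K (λ d _ → ∑Words-∑ l K m (λ j w → h j (d ∷ w))))
                               (∑-comm K m (λ d j → ∑Words l K (λ w → h j (d ∷ w))))

∑Words-∷ʳ : ∀ l K (f : List ℕ → ℕ) → ∑Words (suc l) K f ≡ ∑ K (λ d → ∑Words l K (λ w → f (w ∷ʳ d)))
∑Words-∷ʳ zero    K f = refl
∑Words-∷ʳ (suc l) K f = trans (∑-cong K (λ e _ → ∑Words-∷ʳ l K (λ w → f (e ∷ w))))
                              (∑-comm K K (λ e d → ∑Words l K (λ w → f (e ∷ w ∷ʳ d))))

∑Words-alphabet : ∀ l k t (f : List ℕ → ℕ) → (∀ w → length w ≡ l → f w ≢ 0 → All (_< k) w) →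
                  ∑Words l (t + k) f ≡ ∑Words l k f
∑Words-alphabet zero    k t f support = refl
∑Words-alphabet (suc l) k t f support = begin
  ∑ (t + k) (λ d → ∑Words l (t + k) (λ w → f (d ∷ w)))
    ≡⟨ ∑-truncate (t + k) _ (m≤n+m k t) (λ d k≤d _ → ∑Words-zero l (t + k) (outside d k≤d)) ⟩
  ∑ k (λ d → ∑Words l (t + k) (λ w → f (d ∷ w)))
    ≡⟨ ∑-cong k (λ d _ → ∑Words-alphabet l k t (λ w → f (d ∷ w))
                                         (λ w |w| f≢0 → All.tail (support′ d w |w| f≢0))) ⟩
  ∑ k (λ d → ∑Words l k (λ w → f (d ∷ w)))               ∎
  where
  open ≡-Reasoning
  support′ : ∀ d w → length w ≡ l → f (d ∷ w) ≢ 0 → All (_< k) (d ∷ w)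
  support′ d w |w| = support (d ∷ w) (cong suc |w|)
  outside : ∀ d → k ≤ d → ∀ w → length w ≡ l → f (d ∷ w) ≡ 0
  outside d k≤d w |w| with f (d ∷ w) ≟ 0
  ... | yes f≡0 = f≡0
  ... | no  f≢0 = contradiction (All.head (support′ d w |w| f≢0)) (≤⇒≯ k≤d)

-- Catalan words

lastOr : ℕ → List ℕ → ℕ
lastOr x []       = x
lastOr x (y ∷ ys) = lastOr y ys

endsWithWeakDescent : List ℕ → Bool
endsWithWeakDescent (a ∷ b ∷ [])    = b ≤ᵇ a
endsWithWeakDescent (a ∷ b ∷ c ∷ r) = endsWithWeakDescent (b ∷ c ∷ r)
endsWithWeakDescent _               = false

adjMinSum : List ℕ → ℕ
adjMinSum (h ∷ h' ∷ t) = h ⊓ h' + adjMinSum (h' ∷ t)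
adjMinSum _            = 0

All-lastOr : ∀ {P : ℕ → Set} x xs → All P (x ∷ xs) → P (lastOr x xs)
All-lastOr x []       (p ∷ _)  = p
All-lastOr x (y ∷ ys) (_ ∷ ps) = All-lastOr y ys ps

lastOr-∷ʳ : ∀ x xs d → lastOr x (xs ∷ʳ d) ≡ d
lastOr-∷ʳ x []       d = refl
lastOr-∷ʳ x (y ∷ ys) d = lastOr-∷ʳ y ys d

lastIs-∷ : ∀ x xs b → lastIs (x ∷ xs) b ≡ (lastOr x xs ≡ᵇ b)
lastIs-∷ x []       b = refl
lastIs-∷ x (y ∷ ys) b = lastIs-∷ y ys b

lastIs-∷ʳ : ∀ xs d b → lastIs (xs ∷ʳ d) b ≡ (d ≡ᵇ b)
lastIs-∷ʳ []           d b = refl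
lastIs-∷ʳ (x ∷ [])     d b = refl
lastIs-∷ʳ (x ∷ y ∷ ys) d b = lastIs-∷ʳ (y ∷ ys) d b

stepOK-∷ʳ : ∀ p xs d → stepOK p (xs ∷ʳ d) ≡ stepOK p xs ∧ (d ≤ᵇ suc (lastOr p xs))
stepOK-∷ʳ p []       d = ∧-identityʳ (d ≤ᵇ suc p)
stepOK-∷ʳ p (y ∷ ys) d =
  trans (cong ((y ≤ᵇ suc p) ∧_) (stepOK-∷ʳ y ys d)) (sym (∧-assoc (y ≤ᵇ suc p) _ _))

isCatalan-∷ʳ : ∀ x xs d → isCatalan (x ∷ xs ∷ʳ d) ≡ isCatalan (x ∷ xs) ∧ (d ≤ᵇ suc (lastOr x xs))
isCatalan-∷ʳ x xs d = trans (cong ((x ≡ᵇ 0) ∧_) (stepOK-∷ʳ x xs d)) (sym (∧-assoc (x ≡ᵇ 0) _ _))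

avoidsGeGe-∷ʳ : ∀ xs d →
  avoidsGeGe (xs ∷ʳ d) ≡ avoidsGeGe xs ∧ not (endsWithWeakDescent xs ∧ (d ≤ᵇ lastOr 0 xs))
avoidsGeGe-∷ʳ []              d = refl
avoidsGeGe-∷ʳ (a ∷ [])        d = refl
avoidsGeGe-∷ʳ (a ∷ b ∷ [])    d = ∧-identityʳ _
avoidsGeGe-∷ʳ (a ∷ b ∷ c ∷ r) d =
  trans (cong (not ((b ≤ᵇ a) ∧ (c ≤ᵇ b)) ∧_) (avoidsGeGe-∷ʳ (b ∷ c ∷ r) d))
        (sym (∧-assoc (not ((b ≤ᵇ a) ∧ (c ≤ᵇ b))) _ _))

endsWithWeakDescent-∷ʳ : ∀ x xs d → endsWithWeakDescent (x ∷ xs ∷ʳ d) ≡ (d ≤ᵇ lastOr x xs)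
endsWithWeakDescent-∷ʳ x []           d = refl
endsWithWeakDescent-∷ʳ x (y ∷ [])     d = refl
endsWithWeakDescent-∷ʳ x (y ∷ z ∷ zs) d = endsWithWeakDescent-∷ʳ y (z ∷ zs) d

adjMinSum-∷ʳ : ∀ x xs d → adjMinSum (x ∷ xs ∷ʳ d) ≡ adjMinSum (x ∷ xs) + lastOr x xs ⊓ d
adjMinSum-∷ʳ x []       d = +-identityʳ (x ⊓ d)
adjMinSum-∷ʳ x (y ∷ ys) d = trans (cong (x ⊓ y +_) (adjMinSum-∷ʳ y ys d)) (sym (+-assoc (x ⊓ y) _ _))

stepOK-bound : ∀ p xs → T (stepOK p xs) → All (_≤ length xs + p) xs
stepOK-bound p []       _  = []
stepOK-bound p (y ∷ ys) ok =
  ≤-trans y≤1+p (s≤s (m≤n+m p (length ys)))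
  ∷ All.map (λ z≤ → ≤-trans z≤ (≤-trans (+-monoʳ-≤ (length ys) y≤1+p) (≤-reflexive (+-suc (length ys) p))))
            (stepOK-bound y ys (T-∧ʳ {y ≤ᵇ suc p} ok))
  where
  y≤1+p = ≤ᵇ⇒≤ y (suc p) (T-∧ˡ {y ≤ᵇ suc p} ok)

isCatalan⇒All< : ∀ w → T (isCatalan w) → All (_< length w) w
isCatalan⇒All< []       _  = []
isCatalan⇒All< (x ∷ xs) ok with ≡ᵇ⇒≡ x 0 (T-∧ˡ {x ≡ᵇ 0} ok)
... | refl = z<s ∷ All.map (λ y≤ → s≤s (≤-trans y≤ (≤-reflexive (+-identityʳ _)))) (stepOK-bound 0 xs (T-∧ʳ {true} ok))

-- Interior points

≤ᵇ-∧-<ᵇ : ∀ y h → (y ≤ᵇ h) ∧ (y <ᵇ h) ≡ (y <ᵇ h)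
≤ᵇ-∧-<ᵇ y h with y <ᵇ h | <ᵇ-reflects-< y h
... | true  | ofʸ y<h = ∧-identityʳ (y ≤ᵇ h) ⟨ trans ⟩ ≤ᵇ-true (<⇒≤ y<h)
... | false | ofⁿ _   = ∧-zeroʳ (y ≤ᵇ h)

<ᵇ-⊓ : ∀ y h h' → (y <ᵇ h) ∧ (y <ᵇ h') ≡ (y <ᵇ h ⊓ h')
<ᵇ-⊓ y       zero    h'       = refl
<ᵇ-⊓ y       (suc h) zero     = ∧-zeroʳ (y <ᵇ suc h)
<ᵇ-⊓ zero    (suc h) (suc h') = refl
<ᵇ-⊓ (suc y) (suc h) (suc h') = <ᵇ-⊓ y h h'

interiorPt-first : ∀ h h' t y → interiorPt (h ∷ h' ∷ t) 1 (suc y) ≡ (y <ᵇ h ⊓ h')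
interiorPt-first h h' t y = begin
  (y ≤ᵇ h) ∧ ((y ≤ᵇ h') ∧ ((y <ᵇ h) ∧ (y <ᵇ h')))  ≡⟨ regroup (y ≤ᵇ h) (y ≤ᵇ h') (y <ᵇ h) (y <ᵇ h') ⟩
  ((y ≤ᵇ h) ∧ (y <ᵇ h)) ∧ ((y ≤ᵇ h') ∧ (y <ᵇ h'))  ≡⟨ cong₂ _∧_ (≤ᵇ-∧-<ᵇ y h) (≤ᵇ-∧-<ᵇ y h') ⟩
  (y <ᵇ h) ∧ (y <ᵇ h')                              ≡⟨ <ᵇ-⊓ y h h' ⟩
  (y <ᵇ h ⊓ h')                                     ∎
  where
  open ≡-Reasoning
  regroup : ∀ a b c d → a ∧ (b ∧ (c ∧ d)) ≡ (a ∧ c) ∧ (b ∧ d)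
  regroup = solve 4 (λ a b c d → a :* (b :* (c :* d)) := (a :* c) :* (b :* d)) refl

∑-⟦<ᵇ⟧ : ∀ Y m → ∑ Y (λ y → ⟦ y <ᵇ m ⟧) ≡ Y ⊓ m
∑-⟦<ᵇ⟧ zero    m       = refl
∑-⟦<ᵇ⟧ (suc Y) zero    = ∑-zero (suc Y) (λ _ _ → refl)
∑-⟦<ᵇ⟧ (suc Y) (suc m) = trans (∑-head Y (λ y → ⟦ y <ᵇ suc m ⟧)) (cong suc (∑-⟦<ᵇ⟧ Y m))

column : List ℕ → ℕ → ℕ → ℕ
column w Y x = ∑ Y (λ y → ⟦ interiorPt w x y ⟧)

interiorCount : List ℕ → ℕ → ℕ → ℕ
interiorCount w X Y = ∑ X (column w Y)

interiorCount-suc : ∀ w X Y → interiorCount w (suc X) Y ≡ ∑ X (column w Y ∘ suc)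
interiorCount-suc w X Y = trans (∑-head X (column w Y)) (cong (_+ ∑ X (column w Y ∘ suc)) (∑-zero Y (λ _ _ → refl)))

column-shift : ∀ h t Y x → column (h ∷ t) Y (suc (suc x)) ≡ column t Y (suc x)
column-shift h t Y x = ∑-cong Y shift
  where
  shift : ∀ y → y < Y → ⟦ interiorPt (h ∷ t) (suc (suc x)) y ⟧ ≡ ⟦ interiorPt t (suc x) y ⟧
  shift zero    _ = refl
  shift (suc y) _ = refl

column-first : ∀ h h' t Y → h ⊓ h' < suc Y → column (h ∷ h' ∷ t) (suc Y) 1 ≡ h ⊓ h'
column-first h h' t Y h⊓h'≤Y = begin
  column (h ∷ h' ∷ t) (suc Y) 1                      ≡⟨ ∑-head Y _ ⟩
  ∑ Y (λ y → ⟦ interiorPt (h ∷ h' ∷ t) 1 (suc y) ⟧)  ≡⟨ ∑-cong Y (λ y _ → cong ⟦_⟧ (interiorPt-first h h' t y)) ⟩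
  ∑ Y (λ y → ⟦ y <ᵇ h ⊓ h' ⟧)                        ≡⟨ ∑-⟦<ᵇ⟧ Y (h ⊓ h') ⟩
  Y ⊓ (h ⊓ h')                                       ≡⟨ m≥n⇒m⊓n≡n (≤-pred h⊓h'≤Y) ⟩
  h ⊓ h'                                             ∎
  where open ≡-Reasoning

interiorCount≡adjMinSum : ∀ w X Y → length w ≤ X → All (_< Y) w → interiorCount w X Y ≡ adjMinSum w
interiorCount≡adjMinSum []       X Y _ _ = ∑-zero X (λ x _ → ∑-zero Y (λ y _ → noInterior x y))
  where
  noInterior : ∀ x y → ⟦ interiorPt [] x y ⟧ ≡ 0
  noInterior zero    y       = refl
  noInterior (suc x) zero    = refl
  noInterior (suc x) (suc y) = refl
interiorCount≡adjMinSum (h ∷ []) X Y _ _ = ∑-zero X (λ x _ → ∑-zero Y (λ y _ → cong ⟦_⟧ (noInterior x y)))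
  where
  noInterior : ∀ x y → interiorPt (h ∷ []) x y ≡ false
  noInterior zero    y       = refl
  noInterior (suc x) zero    = refl
  noInterior (suc x) (suc y) = ∧-zeroʳ (inCell (h ∷ []) x y)
interiorCount≡adjMinSum (h ∷ h' ∷ t) (suc (suc X)) (suc Y) (s≤s (s≤s |t|≤X)) (h<Y ∷ h'∷t<Y) = begin
  interiorCount (h ∷ h' ∷ t) (suc (suc X)) (suc Y)  ≡⟨ interiorCount-suc (h ∷ h' ∷ t) (suc X) (suc Y) ⟩
  ∑ (suc X) (column (h ∷ h' ∷ t) (suc Y) ∘ suc)     ≡⟨ ∑-head X _ ⟩
  column (h ∷ h' ∷ t) (suc Y) 1 + ∑ X (column (h ∷ h' ∷ t) (suc Y) ∘ suc ∘ suc)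
    ≡⟨ cong₂ _+_ (column-first h h' t Y (≤-<-trans (m⊓n≤m h h') h<Y))
                 (∑-cong X (λ x _ → column-shift h (h' ∷ t) (suc Y) x)) ⟩
  h ⊓ h' + ∑ X (column (h' ∷ t) (suc Y) ∘ suc)      ≡⟨ cong (h ⊓ h' +_) (sym (interiorCount-suc (h' ∷ t) X (suc Y))) ⟩
  h ⊓ h' + interiorCount (h' ∷ t) (suc X) (suc Y)
    ≡⟨ cong (h ⊓ h' +_) (interiorCount≡adjMinSum (h' ∷ t) (suc X) (suc Y) (s≤s |t|≤X) h'∷t<Y) ⟩
  adjMinSum (h ∷ h' ∷ t)                            ∎
  where open ≡-Reasoning

inter≡adjMinSum : ∀ w → T (isCatalan w) → inter w ≡ adjMinSum w
inter≡adjMinSum w catalan = begin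
  inter w                                                   ≡⟨ sum-map-applyUpTo (suc n) _ (λ x → x) ⟩
  ∑ (suc n) (λ x → countB (interiorPt w x) (upTo (suc n)))  ≡⟨ ∑-cong (suc n) (λ x _ → countB-upTo (suc n) (interiorPt w x)) ⟩
  interiorCount w (suc n) (suc n)
    ≡⟨ interiorCount≡adjMinSum w (suc n) (suc n) (n≤1+n n) (All.map m<n⇒m<1+n (isCatalan⇒All< w catalan)) ⟩
  adjMinSum w                                               ∎
  where
  open ≡-Reasoning
  n = length w

-- Decomposition by the last letter

isCatalanGeGe : List ℕ → Bool
isCatalanGeGe w = isCatalan w ∧ avoidsGeGe w

-- The conjuncts come in this order so that a wrong last letter makes the predicate compute to false.
inClass : ℕ → ℕ → List ℕ → Bool
inClass a b w = lastIs w b ∧ isCatalanGeGe w ∧ (adjMinSum w ≡ᵇ a)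

inClass⇒isCatalan : ∀ a b w → T (inClass a b w) → T (isCatalan w)
inClass⇒isCatalan a b w p = T-∧ˡ {isCatalan w} (T-∧ˡ {isCatalanGeGe w} (T-∧ʳ {lastIs w b} p))

count : ℕ → ℕ → ℕ → ℕ
count zero    a b = 0
count (suc l) a b =
  countB (λ w → isCatalan w ∧ avoidsGeGe w ∧ lastIs w b ∧ (inter w ≡ᵇ a)) (words (suc l) (suc l))

Cgeq≡count : ∀ n a b → Cgeq n a b ≡ ℤ.+ count n a b
Cgeq≡count zero    a b = refl
Cgeq≡count (suc l) a b = refl

membership≡inClass : ∀ a b w → (isCatalan w ∧ avoidsGeGe w ∧ lastIs w b ∧ (inter w ≡ᵇ a)) ≡ inClass a b w
membership≡inClass a b w with isCatalan w in catalan
... | false = sym (∧-zeroʳ (lastIs w b))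
... | true rewrite inter≡adjMinSum w (subst T (sym catalan) _) =
  solve 3 (λ v l i → v :* (l :* i) := l :* (v :* i)) refl (avoidsGeGe w) (lastIs w b) (adjMinSum w ≡ᵇ a)

count≡∑Words : ∀ l K a b → suc l ≤ K → count (suc l) a b ≡ ∑Words (suc l) K (⟦_⟧ ∘ inClass a b)
count≡∑Words l K a b l<K = begin
  count (suc l) a b                                       ≡⟨ countB-words (suc l) (suc l) _ ⟩
  ∑Words (suc l) (suc l) (λ w → ⟦ isCatalan w ∧ avoidsGeGe w ∧ lastIs w b ∧ (inter w ≡ᵇ a) ⟧)
    ≡⟨ ∑Words-cong (suc l) (suc l) (λ w _ → cong ⟦_⟧ (membership≡inClass a b w)) ⟩
  ∑Words (suc l) (suc l) (⟦_⟧ ∘ inClass a b)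
    ≡⟨ sym (∑Words-alphabet (suc l) (suc l) (K ∸ suc l) _ letters<) ⟩
  ∑Words (suc l) (K ∸ suc l + suc l) (⟦_⟧ ∘ inClass a b)
    ≡⟨ cong (λ k → ∑Words (suc l) k (⟦_⟧ ∘ inClass a b)) (m∸n+n≡m l<K) ⟩
  ∑Words (suc l) K (⟦_⟧ ∘ inClass a b)                    ∎
  where
  open ≡-Reasoning
  letters< : ∀ w → length w ≡ suc l → ⟦ inClass a b w ⟧ ≢ 0 → All (_< suc l) w
  letters< w |w| nonzero =
    subst (λ n → All (_< n) w) |w| (isCatalan⇒All< w (inClass⇒isCatalan a b w (⟦⟧≢0⇒T nonzero)))

isCatalanGeGe-∷ʳ : ∀ x xs d → let L = lastOr x xs in
  isCatalanGeGe (x ∷ xs ∷ʳ d)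
    ≡ (d ≤ᵇ suc L) ∧ not (endsWithWeakDescent (x ∷ xs) ∧ (d ≤ᵇ L)) ∧ isCatalanGeGe (x ∷ xs)
isCatalanGeGe-∷ʳ x xs d rewrite isCatalan-∷ʳ x xs d | avoidsGeGe-∷ʳ (x ∷ xs) d =
  solve 4 (λ c s v n → (c :* s) :* (v :* n) := s :* (n :* (c :* v))) refl
    (isCatalan (x ∷ xs)) (d ≤ᵇ suc (lastOr x xs)) (avoidsGeGe (x ∷ xs)) _

inClass-∷ʳ : ∀ a b x xs d → let L = lastOr x xs in
  inClass a b (x ∷ xs ∷ʳ d) ≡ (d ≡ᵇ b) ∧ (d ≤ᵇ suc L) ∧ not (endsWithWeakDescent (x ∷ xs) ∧ (d ≤ᵇ L))
                              ∧ isCatalanGeGe (x ∷ xs) ∧ (adjMinSum (x ∷ xs) + L ⊓ d ≡ᵇ a)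
inClass-∷ʳ a b x xs d rewrite lastIs-∷ʳ (x ∷ xs) d b | isCatalanGeGe-∷ʳ x xs d | adjMinSum-∷ʳ x xs d =
  cong ((d ≡ᵇ b) ∧_) (solve 4 (λ s n v i → (s :* (n :* v)) :* i := s :* (n :* (v :* i))) refl
    (d ≤ᵇ suc (lastOr x xs)) (not (endsWithWeakDescent (x ∷ xs) ∧ (d ≤ᵇ lastOr x xs)))
    (isCatalanGeGe (x ∷ xs)) (adjMinSum (x ∷ xs) + lastOr x xs ⊓ d ≡ᵇ a))

inClass-last : ∀ a m x xs → let u = x ∷ xs in
  isCatalanGeGe u ∧ (adjMinSum u + m ≡ᵇ a) ≡ (m ≤ᵇ a) ∧ inClass (a ∸ m) (lastOr x xs) u
inClass-last a m x xs rewrite lastIs-∷ x xs (lastOr x xs) | ≡ᵇ-true {lastOr x xs} refl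
                            | +≡ᵇ-∸ (adjMinSum (x ∷ xs)) m a =
  solve 3 (λ v m i → v :* (m :* i) := m :* (v :* i)) refl
    (isCatalanGeGe (x ∷ xs)) (m ≤ᵇ a) (adjMinSum (x ∷ xs) ≡ᵇ a ∸ m)

extendsByAscent : ℕ → ℕ → List ℕ → Bool
extendsByAscent a zero    u = false
extendsByAscent a (suc j) u = (j ≤ᵇ a) ∧ inClass (a ∸ j) j u

extendsByDescent : ℕ → ℕ → List ℕ → Bool
extendsByDescent a b u = (b ≤ᵇ lastOr 0 u) ∧ not (endsWithWeakDescent u) ∧ isCatalanGeGe u ∧ (adjMinSum u + b ≡ᵇ a)

extendsByAscent-other : ∀ a b x xs → b ≢ suc (lastOr x xs) → extendsByAscent a b (x ∷ xs) ≡ false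
extendsByAscent-other a zero    x xs _  = refl
extendsByAscent-other a (suc j) x xs b≢ rewrite lastIs-∷ x xs j | ≡ᵇ-false (b≢ ∘ cong suc ∘ sym) = ∧-zeroʳ (j ≤ᵇ a)

inClass-∷ʳ-split : ∀ a b x xs →
  ⟦ inClass a b (x ∷ xs ∷ʳ b) ⟧ ≡ ⟦ extendsByAscent a b (x ∷ xs) ⟧ + ⟦ extendsByDescent a b (x ∷ xs) ⟧
inClass-∷ʳ-split a b x xs rewrite inClass-∷ʳ a b x xs b | ≡ᵇ-true {b} refl with <-cmp b (suc (lastOr x xs))
... | tri< b<1+L b≢ _ rewrite extendsByAscent-other a b x xs b≢ | ≤ᵇ-true (<⇒≤ b<1+L) | ≤ᵇ-true (≤-pred b<1+L)
                            | ∧-identityʳ (endsWithWeakDescent (x ∷ xs)) | m≥n⇒m⊓n≡n (≤-pred b<1+L) = refl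
... | tri≈ _ refl _ rewrite ≤ᵇ-true (≤-refl {suc (lastOr x xs)}) | ≤ᵇ-false (1+n≰n {lastOr x xs})
                          | ∧-zeroʳ (endsWithWeakDescent (x ∷ xs)) | m≤n⇒m⊓n≡m (n≤1+n (lastOr x xs)) =
  trans (cong ⟦_⟧ (inClass-last a (lastOr x xs) x xs)) (sym (+-identityʳ _))
... | tri> _ b≢ 1+L<b rewrite extendsByAscent-other a b x xs b≢ | ≤ᵇ-false (<⇒≱ 1+L<b)
                            | ≤ᵇ-false {b} {lastOr x xs} (<⇒≱ (<-trans (n<1+n _) 1+L<b)) = refl

-- u ends with j, and u ∷ʳ (j + 1) ∷ʳ b lies in the class of (a, b).
extendsByAscentDescent : ℕ → ℕ → ℕ → List ℕ → Bool
extendsByAscentDescent a b j u = (b ≤ᵇ suc j) ∧ (j + b ≤ᵇ a) ∧ inClass (a ∸ (j + b)) j u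

extendsByDescent-∷ʳ : ∀ a b x xs d → let L = lastOr x xs in
  ⟦ extendsByDescent a b (x ∷ xs ∷ʳ d) ⟧
    ≡ (if d ≡ᵇ suc L then ⟦ extendsByAscentDescent a b L (x ∷ xs) ⟧ else 0)
extendsByDescent-∷ʳ a b x xs d rewrite lastOr-∷ʳ x xs d | endsWithWeakDescent-∷ʳ x xs d | isCatalanGeGe-∷ʳ x xs d
                                     | adjMinSum-∷ʳ x xs d with <-cmp d (suc (lastOr x xs))
... | tri< d<1+L d≢ _ rewrite ≤ᵇ-true (≤-pred d<1+L) | ≡ᵇ-false d≢ = cong ⟦_⟧ (∧-zeroʳ (b ≤ᵇ d))
... | tri≈ _ refl _ rewrite ≤ᵇ-false (1+n≰n {lastOr x xs}) | ≤ᵇ-true (≤-refl {suc (lastOr x xs)})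
                          | ∧-zeroʳ (endsWithWeakDescent (x ∷ xs)) | m≤n⇒m⊓n≡m (n≤1+n (lastOr x xs))
                          | ≡ᵇ-true {suc (lastOr x xs)} refl | +-assoc (adjMinSum (x ∷ xs)) (lastOr x xs) b =
  cong (λ p → ⟦ (b ≤ᵇ suc (lastOr x xs)) ∧ p ⟧) (inClass-last a (lastOr x xs + b) x xs)
... | tri> _ d≢ 1+L<d rewrite ≤ᵇ-false (<⇒≱ 1+L<d) | ≤ᵇ-false {d} {lastOr x xs} (<⇒≱ (<-trans (n<1+n _) 1+L<d))
                            | ≡ᵇ-false d≢ = cong ⟦_⟧ (∧-zeroʳ (b ≤ᵇ d))

∑-extendsByDescent-∷ʳ : ∀ K a b x xs → suc (suc (lastOr x xs)) ≤ K →
  ∑ K (λ d → ⟦ extendsByDescent a b (x ∷ xs ∷ʳ d) ⟧) ≡ ⟦ extendsByAscentDescent a b (lastOr x xs) (x ∷ xs) ⟧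
∑-extendsByDescent-∷ʳ K a b x xs 2+L≤K =
  trans (∑-single K (suc L) _ 2+L≤K (λ d _ d≢ → atLetter d ⟨ trans ⟩ cong (if_then X else 0) (≡ᵇ-false d≢)))
        (atLetter (suc L) ⟨ trans ⟩ cong (if_then X else 0) (≡ᵇ-true {suc L} refl))
  where
  L = lastOr x xs
  X = ⟦ extendsByAscentDescent a b L (x ∷ xs) ⟧
  atLetter = extendsByDescent-∷ʳ a b x xs

∑-extendsByAscentDescent : ∀ K a b x xs → lastOr x xs < K →
  ∑ K (λ j → ⟦ extendsByAscentDescent a b j (x ∷ xs) ⟧) ≡ ⟦ extendsByAscentDescent a b (lastOr x xs) (x ∷ xs) ⟧
∑-extendsByAscentDescent K a b x xs L<K = ∑-single K (lastOr x xs) _ L<K otherLast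
  where
  otherLast : ∀ j → j < K → j ≢ lastOr x xs → ⟦ extendsByAscentDescent a b j (x ∷ xs) ⟧ ≡ 0
  otherLast j _ j≢ rewrite lastIs-∷ x xs j | ≡ᵇ-false (j≢ ∘ sym) =
    cong ⟦_⟧ (trans (cong ((b ≤ᵇ suc j) ∧_) (∧-zeroʳ (j + b ≤ᵇ a))) (∧-zeroʳ (b ≤ᵇ suc j)))

extendsByDescent-∷ʳ⇒isCatalan : ∀ a b x xs d → T (extendsByDescent a b (x ∷ xs ∷ʳ d)) → T (isCatalan (x ∷ xs))
extendsByDescent-∷ʳ⇒isCatalan a b x xs d p =
  T-∧ˡ {isCatalan (x ∷ xs)} (subst T (isCatalan-∷ʳ x xs d) (T-∧ˡ {isCatalan w} (T-∧ˡ {isCatalanGeGe w}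
    (T-∧ʳ {not (endsWithWeakDescent w)} (T-∧ʳ {b ≤ᵇ lastOr 0 w} p)))))
  where w = x ∷ xs ∷ʳ d

extendsByAscentDescent⇒isCatalan : ∀ a b j u → T (extendsByAscentDescent a b j u) → T (isCatalan u)
extendsByAscentDescent⇒isCatalan a b j u p =
  inClass⇒isCatalan (a ∸ (j + b)) j u (T-∧ʳ {j + b ≤ᵇ a} (T-∧ʳ {b ≤ᵇ suc j} p))

∑-extendsByDescent≡∑-extendsByAscentDescent : ∀ K a b x xs → suc (length (x ∷ xs)) ≤ K →
  ∑ K (λ d → ⟦ extendsByDescent a b (x ∷ xs ∷ʳ d) ⟧) ≡ ∑ K (λ j → ⟦ extendsByAscentDescent a b j (x ∷ xs) ⟧)
∑-extendsByDescent≡∑-extendsByAscentDescent K a b x xs |u|<K with T? (isCatalan (x ∷ xs))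
... | yes catalan = trans (∑-extendsByDescent-∷ʳ K a b x xs (≤-trans (s≤s L<|u|) |u|<K))
                          (sym (∑-extendsByAscentDescent K a b x xs (<-trans L<|u| |u|<K)))
  where
  L<|u| : lastOr x xs < length (x ∷ xs)
  L<|u| = All-lastOr x xs (isCatalan⇒All< (x ∷ xs) catalan)
... | no ¬catalan =
  trans (∑-zero K (λ d _ → ⟦⟧-zero (¬catalan ∘ extendsByDescent-∷ʳ⇒isCatalan a b x xs d)))
        (sym (∑-zero K (λ j _ → ⟦⟧-zero (¬catalan ∘ extendsByAscentDescent⇒isCatalan a b j (x ∷ xs)))))

-- If f a b is the coefficient of q^a v^b in a series F(q;v), then termQ f, termQV f and termQ²V f
-- are the coefficients of q^a v^b in F(q;q)/(1 − qv), v F(q;qv) and q²v² F(q;q²v)/(1 − qv), and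
-- descentSum (count n) a b counts the words u ∷ʳ (j + 1) ∷ʳ b of the class of (a, b) with |u| = n.
termQ : (ℕ → ℕ → ℕ) → ℕ → ℕ → ℕ
termQ f a b = if b ≤ᵇ a then ∑ (suc (a ∸ b)) (λ t → f (a ∸ b ∸ t) t) else 0

termQV : (ℕ → ℕ → ℕ) → ℕ → ℕ → ℕ
termQV f a zero    = 0
termQV f a (suc j) = if j ≤ᵇ a then f (a ∸ j) j else 0

termQ²VTerm : (ℕ → ℕ → ℕ) → ℕ → ℕ → ℕ → ℕ
termQ²VTerm f a b y =
  if y ≤ᵇ b then ⟦ 2 ≤ᵇ y ⟧ * (if (b ∸ y) * 2 ≤ᵇ a ∸ y then f (a ∸ y ∸ (b ∸ y) * 2) (b ∸ y) else 0) else 0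

termQ²V : (ℕ → ℕ → ℕ) → ℕ → ℕ → ℕ
termQ²V f a b = ∑ (suc a) (termQ²VTerm f a b)

descentTerm : (ℕ → ℕ → ℕ) → ℕ → ℕ → ℕ → ℕ
descentTerm f a b j = if b ≤ᵇ suc j then (if j + b ≤ᵇ a then f (a ∸ (j + b)) j else 0) else 0

descentSum : (ℕ → ℕ → ℕ) → ℕ → ℕ → ℕ
descentSum f a b = ∑ (suc a) (descentTerm f a b)

∑Words-inClass-∷ʳ : ∀ l K a b → b < K →
  ∑Words (suc (suc l)) K (⟦_⟧ ∘ inClass a b)
    ≡ ∑Words (suc l) K (⟦_⟧ ∘ extendsByAscent a b) + ∑Words (suc l) K (⟦_⟧ ∘ extendsByDescent a b)
∑Words-inClass-∷ʳ l K a b b<K = begin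
  ∑Words (suc (suc l)) K (⟦_⟧ ∘ inClass a b)                     ≡⟨ ∑Words-∷ʳ (suc l) K (⟦_⟧ ∘ inClass a b) ⟩
  ∑ K (λ d → ∑Words (suc l) K (λ u → ⟦ inClass a b (u ∷ʳ d) ⟧))
    ≡⟨ ∑-single K b _ b<K (λ d _ d≢b → ∑Words-zero (suc l) K (λ u _ → otherLast u d d≢b)) ⟩
  ∑Words (suc l) K (λ u → ⟦ inClass a b (u ∷ʳ b) ⟧)               ≡⟨ ∑Words-cong (suc l) K split ⟩
  ∑Words (suc l) K (λ u → ⟦ extendsByAscent a b u ⟧ + ⟦ extendsByDescent a b u ⟧)
    ≡⟨ ∑Words-distrib-+ (suc l) K (⟦_⟧ ∘ extendsByAscent a b) (⟦_⟧ ∘ extendsByDescent a b) ⟩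
  ∑Words (suc l) K (⟦_⟧ ∘ extendsByAscent a b) + ∑Words (suc l) K (⟦_⟧ ∘ extendsByDescent a b) ∎
  where
  open ≡-Reasoning
  otherLast : ∀ u d → d ≢ b → ⟦ inClass a b (u ∷ʳ d) ⟧ ≡ 0
  otherLast u d d≢b rewrite lastIs-∷ʳ u d b | ≡ᵇ-false d≢b = refl
  split : ∀ u → length u ≡ suc l →
          ⟦ inClass a b (u ∷ʳ b) ⟧ ≡ ⟦ extendsByAscent a b u ⟧ + ⟦ extendsByDescent a b u ⟧
  split (x ∷ xs) _ = inClass-∷ʳ-split a b x xs

∑Words-extendsByAscent : ∀ l K a b → suc l ≤ K →
  ∑Words (suc l) K (⟦_⟧ ∘ extendsByAscent a b) ≡ termQV (count (suc l)) a b
∑Words-extendsByAscent l K a zero    _   = ∑Words-zero (suc l) K (λ _ _ → refl)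
∑Words-extendsByAscent l K a (suc j) l<K =
  trans (∑Words-∧ (suc l) K (j ≤ᵇ a) (inClass (a ∸ j) j))
        (cong (if j ≤ᵇ a then_else 0) (sym (count≡∑Words l K (a ∸ j) j l<K)))

∑Words-extendsByDescent : ∀ l K a b → suc (suc l) ≤ K →
  ∑Words (suc (suc l)) K (⟦_⟧ ∘ extendsByDescent a b) ≡ ∑ K (descentTerm (count (suc l)) a b)
∑Words-extendsByDescent l K a b 2+l≤K = begin
  ∑Words (suc (suc l)) K (⟦_⟧ ∘ extendsByDescent a b)
    ≡⟨ ∑Words-∷ʳ (suc l) K (⟦_⟧ ∘ extendsByDescent a b) ⟩
  ∑ K (λ d → ∑Words (suc l) K (λ u → ⟦ extendsByDescent a b (u ∷ʳ d) ⟧))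
    ≡⟨ sym (∑Words-∑ (suc l) K K (λ d u → ⟦ extendsByDescent a b (u ∷ʳ d) ⟧)) ⟩
  ∑Words (suc l) K (λ u → ∑ K (λ d → ⟦ extendsByDescent a b (u ∷ʳ d) ⟧))
    ≡⟨ ∑Words-cong (suc l) K byLastLetter ⟩
  ∑Words (suc l) K (λ u → ∑ K (λ j → ⟦ extendsByAscentDescent a b j u ⟧))
    ≡⟨ ∑Words-∑ (suc l) K K (λ j → ⟦_⟧ ∘ extendsByAscentDescent a b j) ⟩
  ∑ K (λ j → ∑Words (suc l) K (⟦_⟧ ∘ extendsByAscentDescent a b j))
    ≡⟨ ∑-cong K (λ j _ → byCount j) ⟩
  ∑ K (descentTerm (count (suc l)) a b) ∎
  where
  open ≡-Reasoning
  byLastLetter : ∀ u → length u ≡ suc l →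
                 ∑ K (λ d → ⟦ extendsByDescent a b (u ∷ʳ d) ⟧) ≡ ∑ K (λ j → ⟦ extendsByAscentDescent a b j u ⟧)
  byLastLetter (x ∷ xs) |u| =
    ∑-extendsByDescent≡∑-extendsByAscentDescent K a b x xs (subst (λ n → suc n ≤ K) (sym |u|) 2+l≤K)
  byCount : ∀ j → ∑Words (suc l) K (⟦_⟧ ∘ extendsByAscentDescent a b j) ≡ descentTerm (count (suc l)) a b j
  byCount j = begin
    ∑Words (suc l) K (⟦_⟧ ∘ extendsByAscentDescent a b j)
      ≡⟨ ∑Words-∧ (suc l) K (b ≤ᵇ suc j) (λ u → (j + b ≤ᵇ a) ∧ inClass (a ∸ (j + b)) j u) ⟩
    (if b ≤ᵇ suc j then ∑Words (suc l) K (λ u → ⟦ (j + b ≤ᵇ a) ∧ inClass (a ∸ (j + b)) j u ⟧) else 0)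
      ≡⟨ cong (if b ≤ᵇ suc j then_else 0) (∑Words-∧ (suc l) K (j + b ≤ᵇ a) (inClass (a ∸ (j + b)) j)) ⟩
    (if b ≤ᵇ suc j then (if j + b ≤ᵇ a then ∑Words (suc l) K (⟦_⟧ ∘ inClass (a ∸ (j + b)) j) else 0) else 0)
      ≡⟨ cong (λ c → if b ≤ᵇ suc j then (if j + b ≤ᵇ a then c else 0) else 0)
              (sym (count≡∑Words l K (a ∸ (j + b)) j (≤-trans (n≤1+n _) 2+l≤K))) ⟩
    descentTerm (count (suc l)) a b j ∎

termQV-empty : ∀ a b → termQV (count 0) a b ≡ 0
termQV-empty a zero    = refl
termQV-empty a (suc j) = if-eta (j ≤ᵇ a)

descentSum-empty : ∀ a b → descentSum (count 0) a b ≡ 0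
descentSum-empty a b =
  ∑-zero (suc a) (λ j _ → trans (cong (if b ≤ᵇ suc j then_else 0) (if-eta (j + b ≤ᵇ a))) (if-eta (b ≤ᵇ suc j)))

count-one : ∀ a b → count 1 a b ≡ ⟦ (a ≡ᵇ 0) ∧ (b ≡ᵇ 0) ⟧
count-one zero    zero    = refl
count-one zero    (suc b) = refl
count-one (suc a) zero    = refl
count-one (suc a) (suc b) = refl

count-two : ∀ a b → count 2 a b ≡ ⟦ (a ≡ᵇ 0) ∧ (b ≡ᵇ 0) ⟧ + termQV (count 1) a b
count-two zero    zero          = refl
count-two zero    1             = refl
count-two zero    (suc (suc b)) = refl
count-two (suc a) zero          = refl
count-two (suc a) 1             = refl
count-two (suc a) (suc (suc b)) = sym (if-eta (b <ᵇ suc a))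

count-recurrence : ∀ l a b →
  count (2 + l) a b ≡ ⟦ (l ≡ᵇ 0) ∧ (a ≡ᵇ 0) ∧ (b ≡ᵇ 0) ⟧ + termQV (count (1 + l)) a b + descentSum (count l) a b
count-recurrence zero a b = begin
  count 2 a b                                         ≡⟨ count-two a b ⟩
  ⟦ (a ≡ᵇ 0) ∧ (b ≡ᵇ 0) ⟧ + termQV (count 1) a b      ≡⟨ sym (+-identityʳ _) ⟩
  ⟦ (a ≡ᵇ 0) ∧ (b ≡ᵇ 0) ⟧ + termQV (count 1) a b + 0
    ≡⟨ cong (⟦ (a ≡ᵇ 0) ∧ (b ≡ᵇ 0) ⟧ + termQV (count 1) a b +_) (sym (descentSum-empty a b)) ⟩
  ⟦ (a ≡ᵇ 0) ∧ (b ≡ᵇ 0) ⟧ + termQV (count 1) a b + descentSum (count 0) a b ∎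
  where open ≡-Reasoning
count-recurrence (suc l) a b = begin
  count (3 + l) a b                                          ≡⟨ count≡∑Words (suc (suc l)) K a b 3+l≤K ⟩
  ∑Words (3 + l) K (⟦_⟧ ∘ inClass a b)                       ≡⟨ ∑Words-inClass-∷ʳ (suc l) K a b b<K ⟩
  ∑Words (2 + l) K (⟦_⟧ ∘ extendsByAscent a b) + ∑Words (2 + l) K (⟦_⟧ ∘ extendsByDescent a b)
    ≡⟨ cong₂ _+_ (∑Words-extendsByAscent (suc l) K a b (≤-trans (n≤1+n _) 3+l≤K))
                 (∑Words-extendsByDescent l K a b (≤-trans (n≤1+n _) 3+l≤K)) ⟩
  termQV (count (2 + l)) a b + ∑ K (descentTerm (count (1 + l)) a b)
    ≡⟨ cong (termQV (count (2 + l)) a b +_) (∑-truncate K (descentTerm (count (suc l)) a b) a<K beyond-a) ⟩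
  termQV (count (2 + l)) a b + descentSum (count (1 + l)) a b ∎
  where
  open ≡-Reasoning
  K = 3 + (l + a + b)
  3+l≤K : 3 + l ≤ K
  3+l≤K = s≤s (s≤s (s≤s (≤-trans (m≤m+n l a) (m≤m+n (l + a) b))))
  b<K : b < K
  b<K = s≤s (≤-trans (m≤n+m b (l + a)) (≤-trans (n≤1+n _) (n≤1+n _)))
  a<K : suc a ≤ K
  a<K = s≤s (≤-trans (≤-trans (m≤n+m a l) (m≤m+n (l + a) b)) (≤-trans (n≤1+n _) (n≤1+n _)))
  beyond-a : ∀ j → suc a ≤ j → j < K → descentTerm (count (suc l)) a b j ≡ 0
  beyond-a j a<j _ rewrite ≤ᵇ-false {j + b} {a} (<⇒≱ (≤-trans a<j (m≤m+n j b))) = if-eta (b ≤ᵇ suc j)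

-- The geometric sum over weak descents

termQ-shifted : ∀ f c b → termQ f (c + b) b ≡ ∑ (suc c) (λ t → f (c ∸ t) t)
termQ-shifted f c b rewrite ≤ᵇ-true (m≤n+m b c) | m+n∸n≡m c b = refl

descentSum-shifted : ∀ f c b → descentSum f (c + b) b ≡ ∑ (suc c) (λ t → if b ≤ᵇ suc t then f (c ∸ t) t else 0)
descentSum-shifted f c b =
  trans (∑-truncate (suc (c + b)) (descentTerm f (c + b) b) (s≤s (m≤m+n c b)) beyond) (∑-cong (suc c) within)
  where
  beyond : ∀ j → suc c ≤ j → j < suc (c + b) → descentTerm f (c + b) b j ≡ 0
  beyond j c<j _ rewrite ≤ᵇ-false (<⇒≱ (+-monoˡ-< b c<j)) = if-eta (b ≤ᵇ suc j)
  within : ∀ j → j < suc c → descentTerm f (c + b) b j ≡ (if b ≤ᵇ suc j then f (c ∸ j) j else 0)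
  within j j<1+c rewrite ≤ᵇ-true (+-monoˡ-≤ b (≤-pred j<1+c)) | +-comm c b | +-comm j b
                       | [m+n]∸[m+o]≡n∸o b c j = refl

*2≤ᵇ+ : ∀ c t → (t * 2 ≤ᵇ c + t) ≡ (t ≤ᵇ c)
*2≤ᵇ+ c t rewrite *-comm t 2 | +-identityʳ t with t ≤? c
... | yes t≤c = trans (≤ᵇ-true (+-monoˡ-≤ t t≤c)) (sym (≤ᵇ-true t≤c))
... | no  t≰c = trans (≤ᵇ-false (t≰c ∘ +-cancelʳ-≤ t t c)) (sym (≤ᵇ-false t≰c))

+∸*2 : ∀ c t → c + t ∸ t * 2 ≡ c ∸ t
+∸*2 c t rewrite *-comm t 2 | +-identityʳ t = trans (sym (∸-+-assoc (c + t) t t)) (cong (_∸ t) (m+n∸n≡m c t))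

2≤ᵇ∸ : ∀ b t → t ≤ b → (2 ≤ᵇ b ∸ t) ≡ not (b ≤ᵇ suc t)
2≤ᵇ∸ b t t≤b with b ≤ᵇ suc t | ≤ᵇ-reflects-≤ b (suc t)
... | true  | ofʸ b≤1+t = ≤ᵇ-false {2} {b ∸ t} (λ 2≤b∸t → <⇒≱ (2+t≤b 2≤b∸t) b≤1+t)
  where
  2+t≤b : 2 ≤ b ∸ t → suc (suc t) ≤ b
  2+t≤b 2≤b∸t = subst (suc (suc t) ≤_) (m∸n+n≡m t≤b) (+-monoˡ-≤ t 2≤b∸t)
... | false | ofⁿ b≰1+t = ≤ᵇ-true {2} {b ∸ t} (subst (_≤ b ∸ t) (m+n∸n≡m 2 t) (∸-monoˡ-≤ t (≰⇒> b≰1+t)))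

termQ²V-shifted : ∀ f c b → termQ²V f (c + b) b ≡ ∑ (suc c) (λ t → if b ≤ᵇ suc t then 0 else f (c ∸ t) t)
termQ²V-shifted f c b = begin
  ∑ (suc (c + b)) G            ≡⟨ ∑-truncate (suc (c + b)) G (s≤s (m≤n+m b c)) beyond-b ⟩
  ∑ (suc b) G                  ≡⟨ ∑-reverse (suc b) G ⟩
  ∑ (suc b) (λ t → G (b ∸ t))  ≡⟨ ∑-cong (suc b) (λ t t<1+b → reflected t (≤-pred t<1+b)) ⟩
  ∑ (suc b) Y                  ≡⟨ sym (∑-truncate (suc (c + b)) Y (s≤s (m≤n+m b c)) (λ t b<t _ → Y-beyond-b t b<t)) ⟩
  ∑ (suc (c + b)) Y            ≡⟨ ∑-truncate (suc (c + b)) Y (s≤s (m≤m+n c b)) (λ t c<t _ → Y-beyond-c t c<t) ⟩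
  ∑ (suc c) Y                  ≡⟨ ∑-cong (suc c) (λ t t<1+c → Y-within t (≤-pred t<1+c)) ⟩
  ∑ (suc c) (λ t → if b ≤ᵇ suc t then 0 else f (c ∸ t) t) ∎
  where
  open ≡-Reasoning
  G Y : ℕ → ℕ
  G = termQ²VTerm f (c + b) b
  Y t = if b ≤ᵇ suc t then 0 else (if t ≤ᵇ c then f (c ∸ t) t else 0)
  beyond-b : ∀ y → suc b ≤ y → y < suc (c + b) → G y ≡ 0
  beyond-b y b<y _ rewrite ≤ᵇ-false (<⇒≱ b<y) = refl
  reflected : ∀ t → t ≤ b → G (b ∸ t) ≡ Y t
  reflected t t≤b rewrite ≤ᵇ-true (m∸n≤m b t) | +-∸-assoc c (m∸n≤m b t) | m∸[m∸n]≡n t≤b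
                        | *2≤ᵇ+ c t | +∸*2 c t | 2≤ᵇ∸ b t t≤b = ⟦not⟧-* (b ≤ᵇ suc t) _
  Y-beyond-b : ∀ t → b < t → Y t ≡ 0
  Y-beyond-b t b<t rewrite ≤ᵇ-true (m≤n⇒m≤1+n (<⇒≤ b<t)) = refl
  Y-beyond-c : ∀ t → c < t → Y t ≡ 0
  Y-beyond-c t c<t rewrite ≤ᵇ-false (<⇒≱ c<t) = if-eta (b ≤ᵇ suc t)
  Y-within : ∀ t → t ≤ c → Y t ≡ (if b ≤ᵇ suc t then 0 else f (c ∸ t) t)
  Y-within t t≤c rewrite ≤ᵇ-true t≤c = refl

split-if : ∀ p x → x ≡ (if p then x else 0) + (if p then 0 else x)
split-if true  x = sym (+-identityʳ x)
split-if false x = refl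

termQ≡descentSum+termQ²V-shifted : ∀ f c b → termQ f (c + b) b ≡ descentSum f (c + b) b + termQ²V f (c + b) b
termQ≡descentSum+termQ²V-shifted f c b = begin
  termQ f (c + b) b                                    ≡⟨ termQ-shifted f c b ⟩
  ∑ (suc c) (λ t → f (c ∸ t) t)                        ≡⟨ ∑-cong (suc c) (λ t _ → split-if (b ≤ᵇ suc t) _) ⟩
  ∑ (suc c) (λ t → D t + A t)                          ≡⟨ ∑-distrib-+ (suc c) D A ⟩
  ∑ (suc c) D + ∑ (suc c) A
    ≡⟨ sym (cong₂ _+_ (descentSum-shifted f c b) (termQ²V-shifted f c b)) ⟩
  descentSum f (c + b) b + termQ²V f (c + b) b         ∎
  where
  open ≡-Reasoning
  D A : ℕ → ℕ
  D t = if b ≤ᵇ suc t then f (c ∸ t) t else 0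
  A t = if b ≤ᵇ suc t then 0 else f (c ∸ t) t

termQ≡descentSum+termQ²V : ∀ f a b → termQ f a b ≡ descentSum f a b + termQ²V f a b
termQ≡descentSum+termQ²V f a b with b ≤? a
... | yes b≤a = subst (λ a → termQ f a b ≡ descentSum f a b + termQ²V f a b) (m∸n+n≡m b≤a)
                      (termQ≡descentSum+termQ²V-shifted f (a ∸ b) b)
... | no b≰a rewrite ≤ᵇ-false b≰a =
  sym (cong₂ _+_ (∑-zero (suc a) (λ j _ → noDescent j)) (∑-zero (suc a) (λ y y<1+a → noShift y (≤-pred y<1+a))))
  where
  a<b = ≰⇒> b≰a
  noDescent : ∀ j → descentTerm f a b j ≡ 0
  noDescent j rewrite ≤ᵇ-false (<⇒≱ (<-≤-trans a<b (m≤n+m b j))) = if-eta (b ≤ᵇ suc j)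
  noShift : ∀ y → y ≤ a → termQ²VTerm f a b y ≡ 0
  noShift y y≤a rewrite ≤ᵇ-false (<⇒≱ (<-≤-trans (∸-monoˡ-< a<b y≤a) (m≤m*n (b ∸ y) 2)))
                      | *-zeroʳ ⟦ 2 ≤ᵇ y ⟧ = if-eta (y ≤ᵇ b)
-- Series with natural-number coefficients

Seriesℕ : Set
Seriesℕ = ℕ → ℕ → ℕ → ℕ

monoℕ : ℕ → ℕ → ℕ → Seriesℕ
monoℕ i j k n a b = if (n ≡ᵇ i) ∧ (a ≡ᵇ j) ∧ (b ≡ᵇ k) then 1 else 0

geomℕ : Seriesℕ
geomℕ n a b = if (n ≡ᵇ 0) ∧ (a ≡ᵇ b) then 1 else 0

infixl 6 _⊕ℕ_
infixl 7 _⊛ℕ_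

_⊕ℕ_ : Seriesℕ → Seriesℕ → Seriesℕ
(f ⊕ℕ g) n a b = f n a b + g n a b

_⊛ℕ_ : Seriesℕ → Seriesℕ → Seriesℕ
(f ⊛ℕ g) n a b =
  ∑ (suc n) λ n₁ → ∑ (suc a) λ a₁ → ∑ (suc b) λ b₁ → f n₁ a₁ b₁ * g (n ∸ n₁) (a ∸ a₁) (b ∸ b₁)

substVℕ : ℕ → ℕ → Seriesℕ → Seriesℕ
substVℕ k m f n a b = ∑ (suc (a + b)) λ j → if ((j * m) ≡ᵇ b) ∧ ((j * k) ≤ᵇ a) then f n (a ∸ (j * k)) j else 0

mono-⊛ℕ : ∀ i j k (g : Seriesℕ) n a b →
  (monoℕ i j k ⊛ℕ g) n a b ≡ (if (i ≤ᵇ n) ∧ (j ≤ᵇ a) ∧ (k ≤ᵇ b) then g (n ∸ i) (a ∸ j) (b ∸ k) else 0)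
mono-⊛ℕ i j k g n a b = begin
  (monoℕ i j k ⊛ℕ g) n a b
    ≡⟨ ∑-single-≤ᵇ n i _ (λ x _ x≢i → ∑-zero (suc a) (λ y _ → ∑-zero (suc b) (λ z _ → offˣ x y z x≢i))) ⟩
  (if i ≤ᵇ n then ∑ (suc a) (λ y → ∑ (suc b) (term i y)) else 0)
    ≡⟨ cong (if i ≤ᵇ n then_else 0) (∑-single-≤ᵇ a j _ (λ y _ y≢j → ∑-zero (suc b) (λ z _ → offʸ y z y≢j))) ⟩
  (if i ≤ᵇ n then (if j ≤ᵇ a then ∑ (suc b) (term i j) else 0) else 0)
    ≡⟨ cong (λ s → if i ≤ᵇ n then (if j ≤ᵇ a then s else 0) else 0) (∑-single-≤ᵇ b k _ (λ z _ → offᶻ z)) ⟩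
  (if i ≤ᵇ n then (if j ≤ᵇ a then (if k ≤ᵇ b then term i j k else 0) else 0) else 0)
    ≡⟨ cong (λ s → if i ≤ᵇ n then (if j ≤ᵇ a then (if k ≤ᵇ b then s else 0) else 0) else 0) atMonomial ⟩
  (if i ≤ᵇ n then (if j ≤ᵇ a then (if k ≤ᵇ b then G else 0) else 0) else 0)
    ≡⟨ sym (trans (if-∧ (i ≤ᵇ n)) (cong (if i ≤ᵇ n then_else 0) (if-∧ (j ≤ᵇ a)))) ⟩
  (if (i ≤ᵇ n) ∧ (j ≤ᵇ a) ∧ (k ≤ᵇ b) then G else 0) ∎
  where
  open ≡-Reasoning
  G = g (n ∸ i) (a ∸ j) (b ∸ k)
  term : ℕ → ℕ → ℕ → ℕ
  term x y z = monoℕ i j k x y z * g (n ∸ x) (a ∸ y) (b ∸ z)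
  offˣ : ∀ x y z → x ≢ i → term x y z ≡ 0
  offˣ x y z x≢i rewrite ≡ᵇ-false x≢i = refl
  offʸ : ∀ y z → y ≢ j → term i y z ≡ 0
  offʸ y z y≢j rewrite ≡ᵇ-true {i} refl | ≡ᵇ-false y≢j = refl
  offᶻ : ∀ z → z ≢ k → term i j z ≡ 0
  offᶻ z z≢k rewrite ≡ᵇ-true {i} refl | ≡ᵇ-true {j} refl | ≡ᵇ-false z≢k = refl
  atMonomial : term i j k ≡ G
  atMonomial rewrite ≡ᵇ-true {i} refl | ≡ᵇ-true {j} refl | ≡ᵇ-true {k} refl = +-identityʳ G

diagonal-⊛ℕ : ∀ i (φ : ℕ → ℕ) (h g : Seriesℕ) →
  (∀ x y z → h x y z ≡ (if (x ≡ᵇ i) ∧ (y ≡ᵇ z) then φ y else 0)) →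
  ∀ n a b → (h ⊛ℕ g) n a b
              ≡ (if i ≤ᵇ n then ∑ (suc a) (λ y → if y ≤ᵇ b then φ y * g (n ∸ i) (a ∸ y) (b ∸ y) else 0) else 0)
diagonal-⊛ℕ i φ h g h-diagonal n a b =
  trans (∑-single-≤ᵇ n i _ (λ x _ x≢i → ∑-zero (suc a) (λ y _ → ∑-zero (suc b) (λ z _ → offColumn x y z x≢i))))
        (cong (if i ≤ᵇ n then_else 0) (∑-cong (suc a) (λ y _ → onColumn y)))
  where
  offColumn : ∀ x y z → x ≢ i → h x y z * g (n ∸ x) (a ∸ y) (b ∸ z) ≡ 0
  offColumn x y z x≢i rewrite h-diagonal x y z | ≡ᵇ-false x≢i = refl
  offDiagonal : ∀ y z → z ≢ y → h i y z * g (n ∸ i) (a ∸ y) (b ∸ z) ≡ 0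
  offDiagonal y z z≢y rewrite h-diagonal i y z | ≡ᵇ-true {i} refl | ≡ᵇ-false (z≢y ∘ sym) = refl
  onDiagonal : ∀ y → h i y y ≡ φ y
  onDiagonal y rewrite h-diagonal i y y | ≡ᵇ-true {i} refl | ≡ᵇ-true {y} refl = refl
  onColumn : ∀ y → ∑ (suc b) (λ z → h i y z * g (n ∸ i) (a ∸ y) (b ∸ z))
                   ≡ (if y ≤ᵇ b then φ y * g (n ∸ i) (a ∸ y) (b ∸ y) else 0)
  onColumn y = trans (∑-single-≤ᵇ b y _ (λ z _ → offDiagonal y z))
                     (cong (λ c → if y ≤ᵇ b then c * g (n ∸ i) (a ∸ y) (b ∸ y) else 0) (onDiagonal y))

substVℕ-linear : ∀ k (f : Seriesℕ) n a b → substVℕ k 1 f n a b ≡ (if b * k ≤ᵇ a then f n (a ∸ b * k) b else 0)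
substVℕ-linear k f n a b = ∑-single (suc (a + b)) b (term n) (s≤s (m≤n+m b a)) otherPower ⟨ trans ⟩ atPower
  where
  term : ℕ → ℕ → ℕ
  term n j = if (j * 1 ≡ᵇ b) ∧ (j * k ≤ᵇ a) then f n (a ∸ j * k) j else 0
  otherPower : ∀ j → j < suc (a + b) → j ≢ b → term n j ≡ 0
  otherPower j _ j≢b rewrite *-identityʳ j | ≡ᵇ-false j≢b = refl
  atPower : term n b ≡ (if b * k ≤ᵇ a then f n (a ∸ b * k) b else 0)
  atPower rewrite *-identityʳ b | ≡ᵇ-true {b} refl = refl

substVℕ-constant : ∀ (f : Seriesℕ) n a b →
  substVℕ 1 0 f n a b ≡ (if b ≡ᵇ 0 then ∑ (suc a) (λ j → f n (a ∸ j) j) else 0)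
substVℕ-constant f n a zero    rewrite +-identityʳ a = ∑-cong (suc a) inRange
  where
  inRange : ∀ j → j < suc a → (if (j * 0 ≡ᵇ 0) ∧ (j * 1 ≤ᵇ a) then f n (a ∸ j * 1) j else 0) ≡ f n (a ∸ j) j
  inRange j j<1+a rewrite *-zeroʳ j | *-identityʳ j | ≤ᵇ-true (≤-pred j<1+a) = refl
substVℕ-constant f n a (suc b) = ∑-zero (suc (a + suc b)) (λ j _ → noPower j)
  where
  noPower : ∀ j → (if (j * 0 ≡ᵇ suc b) ∧ (j * 1 ≤ᵇ a) then f n (a ∸ j * 1) j else 0) ≡ 0
  noPower j rewrite *-zeroʳ j = refl

x²-geomQV-diagonal : ∀ x y z → (monoℕ 2 0 0 ⊛ℕ geomℕ) x y z ≡ (if (x ≡ᵇ 2) ∧ (y ≡ᵇ z) then 1 else 0)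
x²-geomQV-diagonal x y z rewrite mono-⊛ℕ 2 0 0 geomℕ x y z with x
... | 0                 = refl
... | 1                 = refl
... | 2                 = refl
... | suc (suc (suc _)) = refl

x²q²v²-geomQV-diagonal : ∀ x y z →
  (monoℕ 2 2 2 ⊛ℕ geomℕ) x y z ≡ (if (x ≡ᵇ 2) ∧ (y ≡ᵇ z) then ⟦ 2 ≤ᵇ y ⟧ else 0)
x²q²v²-geomQV-diagonal x y z rewrite mono-⊛ℕ 2 2 2 geomℕ x y z with x | y | z
... | 0                 | _           | _           = refl
... | 1                 | _           | _           = refl
... | suc (suc (suc _)) | y           | z           = if-eta ((2 ≤ᵇ y) ∧ (2 ≤ᵇ z))
... | 2                 | 0           | z           = sym (if-eta (0 ≡ᵇ z))
... | 2                 | 1           | z           = sym (if-eta (1 ≡ᵇ z))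
... | 2                 | suc (suc _) | 0           = refl
... | 2                 | suc (suc _) | 1           = refl
... | 2                 | suc (suc _) | suc (suc _) = refl

termQ-coefficient : ∀ (f : Seriesℕ) n a b →
  (monoℕ 2 0 0 ⊛ℕ geomℕ ⊛ℕ substVℕ 1 0 f) n a b ≡ (if 2 ≤ᵇ n then termQ (f (n ∸ 2)) a b else 0)
termQ-coefficient f n a b =
  trans (diagonal-⊛ℕ 2 (λ _ → 1) (monoℕ 2 0 0 ⊛ℕ geomℕ) (substVℕ 1 0 f) x²-geomQV-diagonal n a b)
        (cong (if 2 ≤ᵇ n then_else 0) (trans (∑-single-≤ᵇ a b _ (λ y _ → offDiagonal y)) atDiagonal))
  where
  m = n ∸ 2
  offDiagonal : ∀ y → y ≢ b → (if y ≤ᵇ b then 1 * substVℕ 1 0 f m (a ∸ y) (b ∸ y) else 0) ≡ 0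
  offDiagonal y y≢b with y ≤? b
  ... | no  y≰b rewrite ≤ᵇ-false y≰b = refl
  ... | yes y≤b rewrite ≤ᵇ-true y≤b | substVℕ-constant f m (a ∸ y) (b ∸ y)
                      | ≡ᵇ-false (y≢b ∘ ≤-antisym y≤b ∘ m∸n≡0⇒m≤n) = refl
  atDiagonal : (if b ≤ᵇ a then (if b ≤ᵇ b then 1 * substVℕ 1 0 f m (a ∸ b) (b ∸ b) else 0) else 0)
               ≡ termQ (f m) a b
  atDiagonal rewrite ≤ᵇ-true (≤-refl {b}) | n∸n≡0 b | substVℕ-constant f m (a ∸ b) 0 =
    cong (if b ≤ᵇ a then_else 0) (+-identityʳ _)

termQV-coefficient : ∀ (f : Seriesℕ) n a b →
  (monoℕ 1 0 1 ⊛ℕ substVℕ 1 1 f) n a b ≡ (if 1 ≤ᵇ n then termQV (f (n ∸ 1)) a b else 0)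
termQV-coefficient f n a b rewrite mono-⊛ℕ 1 0 1 (substVℕ 1 1 f) n a b with n | b
... | zero  | _     = refl
... | suc _ | zero  = refl
... | suc n | suc j rewrite substVℕ-linear 1 f n a j | *-identityʳ j = refl

termQ²V-coefficient : ∀ (f : Seriesℕ) n a b →
  (monoℕ 2 2 2 ⊛ℕ geomℕ ⊛ℕ substVℕ 2 1 f) n a b ≡ (if 2 ≤ᵇ n then termQ²V (f (n ∸ 2)) a b else 0)
termQ²V-coefficient f n a b =
  trans (diagonal-⊛ℕ 2 (λ y → ⟦ 2 ≤ᵇ y ⟧) (monoℕ 2 2 2 ⊛ℕ geomℕ) (substVℕ 2 1 f) x²q²v²-geomQV-diagonal n a b)
        (cong (if 2 ≤ᵇ n then_else 0) (∑-cong (suc a) (λ y _ →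
          cong (λ s → if y ≤ᵇ b then ⟦ 2 ≤ᵇ y ⟧ * s else 0) (substVℕ-linear 2 f (n ∸ 2) (a ∸ y) (b ∸ y)))))

recurrenceℕ : ∀ n a b →
  (monoℕ 1 0 0 ⊕ℕ monoℕ 2 0 0 ⊕ℕ monoℕ 2 0 0 ⊛ℕ geomℕ ⊛ℕ substVℕ 1 0 count
                               ⊕ℕ monoℕ 1 0 1 ⊛ℕ substVℕ 1 1 count) n a b
    ≡ (count ⊕ℕ monoℕ 2 2 2 ⊛ℕ geomℕ ⊛ℕ substVℕ 2 1 count) n a b
recurrenceℕ n a b rewrite termQ-coefficient count n a b | termQV-coefficient count n a b
                        | termQ²V-coefficient count n a b with n
... | 0 = refl
... | 1 rewrite termQV-empty a b | count-one a b = trans (+-identityʳ _) (+-identityʳ _)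
... | suc (suc l) rewrite termQ≡descentSum+termQ²V (count l) a b | count-recurrence l a b =
  rearrange (monoℕ 2 0 0 (2 + l) a b) (descentSum (count l) a b) (termQ²V (count l) a b) (termQV (count (1 + l)) a b)
  where
  rearrange : ∀ m d t x → m + (d + t) + x ≡ m + x + d + t
  rearrange m d t x = begin
    m + (d + t) + x    ≡⟨ +-assoc m (d + t) x ⟩
    m + (d + t + x)    ≡⟨ cong (m +_) (+-comm (d + t) x) ⟩
    m + (x + (d + t))  ≡⟨ sym (+-assoc m x (d + t)) ⟩
    m + x + (d + t)    ≡⟨ sym (+-assoc (m + x) d t) ⟩
    m + x + d + t      ∎
    where open ≡-Reasoning

-- Transfer to integer coefficients

toSeries : Seriesℕ → Series
toSeries f n a b = ℤ.+ f n a b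

sumTo-cong : ∀ m {f g : ℕ → ℤ.ℤ} → (∀ x → f x ≡ g x) → sumTo m f ≡ sumTo m g
sumTo-cong zero    f≡g = refl
sumTo-cong (suc m) f≡g = cong₂ ℤ._+_ (sumTo-cong m f≡g) (f≡g m)

sumTo-+ : ∀ m (f : ℕ → ℕ) → sumTo m (λ x → ℤ.+ f x) ≡ ℤ.+ ∑ m f
sumTo-+ zero    f = refl
sumTo-+ (suc m) f = cong (ℤ._+ ℤ.+ f m) (sumTo-+ m f)

mono-toSeries : ∀ i j k → mono i j k ≈S toSeries (monoℕ i j k)
mono-toSeries i j k n a b = sym (if-float ℤ.+_ ((n ≡ᵇ i) ∧ (a ≡ᵇ j) ∧ (b ≡ᵇ k)))

geomQV-toSeries : geomQV ≈S toSeries geomℕ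
geomQV-toSeries n a b = sym (if-float ℤ.+_ ((n ≡ᵇ 0) ∧ (a ≡ᵇ b)))

⊕-toSeries : ∀ {F G f g} → F ≈S toSeries f → G ≈S toSeries g → F ⊕ G ≈S toSeries (f ⊕ℕ g)
⊕-toSeries F≈f G≈g n a b = cong₂ ℤ._+_ (F≈f n a b) (G≈g n a b)

⊛-toSeries : ∀ {F G f g} → F ≈S toSeries f → G ≈S toSeries g → F ⊛ G ≈S toSeries (f ⊛ℕ g)
⊛-toSeries {F} {G} {f} {g} F≈f G≈g n a b =
  sumTo-cong (suc n) (λ n₁ → trans (sumTo-cong (suc a) (λ a₁ → trans (sumTo-cong (suc b) (λ b₁ → product n₁ a₁ b₁))
                                                                     (sumTo-+ (suc b) _)))
                                   (sumTo-+ (suc a) _))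
  ⟨ trans ⟩ sumTo-+ (suc n) _
  where
  product : ∀ n₁ a₁ b₁ → F n₁ a₁ b₁ ℤ.* G (n ∸ n₁) (a ∸ a₁) (b ∸ b₁)
                         ≡ ℤ.+ (f n₁ a₁ b₁ * g (n ∸ n₁) (a ∸ a₁) (b ∸ b₁))
  product n₁ a₁ b₁ = trans (cong₂ ℤ._*_ (F≈f n₁ a₁ b₁) (G≈g (n ∸ n₁) (a ∸ a₁) (b ∸ b₁)))
                           (sym (ℤ.pos-* (f n₁ a₁ b₁) (g (n ∸ n₁) (a ∸ a₁) (b ∸ b₁))))

substV-toSeries : ∀ k m {F f} → F ≈S toSeries f → substV k m F ≈S toSeries (substVℕ k m f)
substV-toSeries k m {F} {f} F≈f n a b = sumTo-cong (suc (a + b)) term ⟨ trans ⟩ sumTo-+ (suc (a + b)) _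
  where
  term : ∀ j → (if (j * m ≡ᵇ b) ∧ (j * k ≤ᵇ a) then F n (a ∸ j * k) j else ℤ.+ 0)
               ≡ ℤ.+ (if (j * m ≡ᵇ b) ∧ (j * k ≤ᵇ a) then f n (a ∸ j * k) j else 0)
  term j = trans (cong (if (j * m ≡ᵇ b) ∧ (j * k ≤ᵇ a) then_else ℤ.+ 0) (F≈f n (a ∸ j * k) j))
                 (sym (if-float ℤ.+_ ((j * m ≡ᵇ b) ∧ (j * k ≤ᵇ a))))

[m+n]-n≡m : ∀ m n → ℤ.+ (m + n) ℤ.- ℤ.+ n ≡ ℤ.+ m
[m+n]-n≡m m n = trans (ℤ.[+m]-[+n]≡m⊖n (m + n) n) (trans (ℤ.⊖-≥ (m≤n+m n m)) (cong ℤ.+_ (m+n∸n≡m m n)))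

theorem5p1 : Cgeq ≈S mono 1 0 0 ⊕ mono 2 0 0
                      ⊕ mono 2 0 0 ⊛ geomQV ⊛ substV 1 0 Cgeq
                      ⊕ mono 1 0 1 ⊛ substV 1 1 Cgeq
                      ⊖ mono 2 2 2 ⊛ geomQV ⊛ substV 2 1 Cgeq
theorem5p1 n a b = begin
  Cgeq n a b                                       ≡⟨ Cgeq≡count n a b ⟩
  ℤ.+ count n a b                                  ≡⟨ sym ([m+n]-n≡m (count n a b) (negative n a b)) ⟩
  ℤ.+ (count ⊕ℕ negative) n a b ℤ.- ℤ.+ negative n a b
    ≡⟨ cong (λ x → ℤ.+ x ℤ.- ℤ.+ negative n a b) (sym (recurrenceℕ n a b)) ⟩
  ℤ.+ positive n a b ℤ.- ℤ.+ negative n a b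
    ≡⟨ sym (cong₂ ℤ._-_ (positive-toSeries n a b) (negative-toSeries n a b)) ⟩
  (mono 1 0 0 ⊕ mono 2 0 0 ⊕ mono 2 0 0 ⊛ geomQV ⊛ substV 1 0 Cgeq ⊕ mono 1 0 1 ⊛ substV 1 1 Cgeq
    ⊖ mono 2 2 2 ⊛ geomQV ⊛ substV 2 1 Cgeq) n a b ∎
  where
  open ≡-Reasoning
  positive negative : Seriesℕ
  positive = monoℕ 1 0 0 ⊕ℕ monoℕ 2 0 0 ⊕ℕ monoℕ 2 0 0 ⊛ℕ geomℕ ⊛ℕ substVℕ 1 0 count
                                       ⊕ℕ monoℕ 1 0 1 ⊛ℕ substVℕ 1 1 count
  negative = monoℕ 2 2 2 ⊛ℕ geomℕ ⊛ℕ substVℕ 2 1 count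
  positive-toSeries : mono 1 0 0 ⊕ mono 2 0 0 ⊕ mono 2 0 0 ⊛ geomQV ⊛ substV 1 0 Cgeq ⊕ mono 1 0 1 ⊛ substV 1 1 Cgeq
                      ≈S toSeries positive
  positive-toSeries =
    ⊕-toSeries (⊕-toSeries (⊕-toSeries (mono-toSeries 1 0 0) (mono-toSeries 2 0 0))
                           (⊛-toSeries (⊛-toSeries (mono-toSeries 2 0 0) geomQV-toSeries) (substV-toSeries 1 0 Cgeq≡count)))
               (⊛-toSeries (mono-toSeries 1 0 1) (substV-toSeries 1 1 Cgeq≡count))
  negative-toSeries : mono 2 2 2 ⊛ geomQV ⊛ substV 2 1 Cgeq ≈S toSeries negative
  negative-toSeries = ⊛-toSeries (⊛-toSeries (mono-toSeries 2 2 2) geomQV-toSeries) (substV-toSeries 2 1 Cgeq≡count)
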